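{- Let $\mathbb{Z}_2^n$ denote the group $(\{0,1\}^n, +)$ with componentwise addition modulo 2, and let $F_n = \mathbb{Z}_2^n \setminus \{0\}$. Let $n > 2$ be an integer. Suppose there exists a permutation $(v_1, \ldots, v_{2^n-1})$ of $F_n$ such that $v_{i-1} + v_i + v_{i+1} = 0$ for every $i \in \{2, 4, \ldots, 2^n - 2\}$. Then there exists a permutation $(w_1, \ldots, w_{2^{n+2}-1})$ of $F_{n+2}$ such that $w_{i-1} + w_i + w_{i+1} = 0$ for every $i \in \{2, 4, \ldots, 2^{n+2} - 2\}$. -}

module Defs where

open import Data.Bool using (Bool; false; _xor_)
open import Data.Nat using (ℕ; _+_; _*_; _∸_; _^_; _<_)
open import Data.Fin using (Fin; fromℕ<)
open import Data.Vec using (Vec; zipWith; replicate)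
open import Data.Product using (Σ; _×_; ∃-syntax)
open import Relation.Binary.PropositionalEquality using (_≡_)
open import Relation.Nullary using (¬_)
open import Function.Definitions using (Injective)

Z2^ : ℕ → Set
Z2^ n = Vec Bool n

_⊕_ : ∀ {n} → Z2^ n → Z2^ n → Z2^ n
_⊕_ = zipWith _xor_

infixl 6 _⊕_

𝟎 : ∀ {n} → Z2^ n
𝟎 {n} = replicate n false

-- F_n = Z_2^n \ {0}; its size is 2^n - 1.
size : ℕ → ℕ
size n = 2 ^ n ∸ 1

-- A permutation (v_1, ..., v_{2^n - 1}) of F_n, indexed 0-based by Fin (2^n - 1):
-- every entry is nonzero, entries are pairwise distinct, and every nonzero
-- element occurs.
IsPermOfF : (n : ℕ) → (Fin (size n) → Z2^ n) → Set
IsPermOfF n v =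
  (∀ i → ¬ (v i ≡ 𝟎)) ×
  Injective _≡_ _≡_ v ×
  (∀ (x : Z2^ n) → ¬ (x ≡ 𝟎) → ∃[ i ] v i ≡ x)

-- With 0-based index j = i - 1 = 2k+1, the triple is (2k, 2k+1, 2k+2), and the
-- range of i corresponds exactly to 2k + 2 < 2^n - 1.
TripleCondition : (n : ℕ) → (Fin (size n) → Z2^ n) → Set
TripleCondition n v =
  ∀ (k : ℕ) (h : 2 * k + 2 < size n) →
    v (fromℕ< {2 * k} (lem1 {k} h)) ⊕ v (fromℕ< {2 * k + 1} (lem2 {k} h)) ⊕ v (fromℕ< h) ≡ 𝟎
  where
    open import Data.Nat.Properties using (<-trans; +-monoʳ-<; n<1+n; m<m+n)
    lem2 : ∀ {k} → 2 * k + 2 < size n → 2 * k + 1 < size n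
    lem2 {k} h = <-trans (+-monoʳ-< (2 * k) (n<1+n 1)) h
    lem1 : ∀ {k} → 2 * k + 2 < size n → 2 * k < size n
    lem1 {k} h = <-trans (m<m+n (2 * k) (n<1+n 0)) (lem2 {k} h)

GoodPerm : ℕ → Set
GoodPerm n = Σ (Fin (size n) → Z2^ n) λ v → IsPermOfF n v × TripleCondition n v

module Submission where

-- Read a good permutation as a walk F₀ G₀ F₁ G₁ … G_{m-1} F_m through Z₂ⁿ ∖ {0} with
-- F_e + G_e + F_{e+1} = 0.  Write Z₂ⁿ⁺² = Z₂ⁿ × GF(4).  Since a + ωa + ω²a = 0 in GF(4),
-- for every a ∈ GF(4) the walk lifts to Z₂ⁿ⁺² by labelling G_e with ω²a and F_e alternately
-- with ωa and a.  The new walk runs through the interior F₁ … F_c (c = m − 1) four times, along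
-- the lifts for a = 0, ω², ω, 1, alternately upwards and downwards; short turns at the two ends
-- use F₀, G₀, F_m, G_c and the vectors (0, ℓ), ℓ ≠ 0, with the labels the lifts do not give them.
-- The turns need c to be even, which holds because 2^n − 1 = 2m + 1 ≡ 7 (mod 8) for n ≥ 3.
-- The walk then meets every nonzero vector and has 2^{n+2} − 1 entries, so it is a permutation.

open import Defs
open import Data.Bool using (false; true; _xor_)
open import Data.Bool.Properties using (xor-assoc; xor-comm; xor-identityʳ; xor-same) renaming (_≟_ to _≟ᵇ_)
open import Data.Nat using (ℕ; zero; suc; _+_; _*_; _^_; _<_; _≤_; _<?_; s≤s; s≤s⁻¹; s<s⁻¹; z≤n; parity)
open import Data.Nat.Properties
  using (+-comm; +-suc; *-suc; +-monoʳ-<; *-monoʳ-≤; *-monoʳ-<; *-cancelˡ-≤; *-cancelˡ-<; <-trans; <⇒≤; m<m+n; n<1+n;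
         m≤n⇒m<n∨m≡n; suc-pred; m^n≢0; ^-distribˡ-+-*)
import Data.Nat.Properties as ℕ
open import Data.Nat.ListAction using (sum)
open import Data.Nat.Tactic.RingSolver using (solve-∀)
open import Data.Parity.Base using (Parity; 0ℙ; 1ℙ; _⁻¹)
open import Data.Parity.Properties using (suc-homo-⁻¹; *-homo-*)
open import Data.Fin as Fin using (Fin; zero; suc; toℕ; fromℕ<; cast; quotient; remainder; combine; punchOut)
open import Data.Fin.Patterns using (0F; 1F; 2F; 3F; 4F; 5F; 6F; 7F)
open import Data.Fin.Properties
  using (2↔Bool; combine-remQuot; toℕ-cast; toℕ-fromℕ<; fromℕ<-toℕ; toℕ<n; toℕ-injective; 0≢1+n;
         punchOut-injective; <⇒notInjective)
import Data.Fin.Properties as Fin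
open import Data.Vec using ([]; _∷_; _++_; splitAt)
open import Data.Vec.Properties using (zipWith-assoc; zipWith-comm; zipWith-identityʳ; zipWith-++; ∷-injective; ≡-dec)
open import Data.List as List using (List; []; _∷_; length; concat; lookup)
open import Data.List.Properties using (length-++)
open import Data.List.Membership.Propositional using (_∈_)
open import Data.List.Membership.Propositional.Properties using (∈-++⁺ˡ; ∈-++⁺ʳ; ∈-concat⁺′; ∈-lookup)
open import Data.List.Relation.Unary.Any using (here; there)
open import Data.Product using (_×_; _,_; proj₁; proj₂; ∃-syntax)
import Data.Sum as Sum
open import Data.Sum using (_⊎_; inj₁; inj₂; [_,_]′)
open import Function using (_∘_; id; flip)
open import Function.Bundles using (Inverse; Injection)
open import Function.Properties.Inverse using (↔⇒↣)
open import Function.Definitions using (Injective)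
open import Relation.Nullary using (yes; no; contradiction)
open import Relation.Binary.PropositionalEquality

private variable
  k l : ℕ
  x y z : Z2^ k

⊕-assoc : (x y z : Z2^ k) → x ⊕ y ⊕ z ≡ x ⊕ (y ⊕ z)
⊕-assoc = zipWith-assoc xor-assoc

⊕-comm : (x y : Z2^ k) → x ⊕ y ≡ y ⊕ x
⊕-comm = zipWith-comm xor-comm

⊕-identityʳ : (x : Z2^ k) → x ⊕ 𝟎 ≡ x
⊕-identityʳ = zipWith-identityʳ xor-identityʳ

⊕-self : (x : Z2^ k) → x ⊕ x ≡ 𝟎
⊕-self []      = refl
⊕-self (b ∷ x) = cong₂ _∷_ (xor-same b) (⊕-self x)

𝟎++𝟎 : 𝟎 {k} ++ 𝟎 {l} ≡ 𝟎
𝟎++𝟎 {zero}  = refl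
𝟎++𝟎 {suc k} = cong (false ∷_) (𝟎++𝟎 {k})

⊕₃-rotate : x ⊕ y ⊕ z ≡ 𝟎 → y ⊕ z ⊕ x ≡ 𝟎
⊕₃-rotate {x = x} {y} {z} xyz = trans (trans (⊕-comm (y ⊕ z) x) (sym (⊕-assoc x y z))) xyz

⊕₃-swap : x ⊕ y ⊕ z ≡ 𝟎 → y ⊕ x ⊕ z ≡ 𝟎
⊕₃-swap {x = x} {y} {z} xyz = trans (cong (_⊕ z) (⊕-comm y x)) xyz

⊕₃-reverse : x ⊕ y ⊕ z ≡ 𝟎 → z ⊕ y ⊕ x ≡ 𝟎
⊕₃-reverse = ⊕₃-swap ∘ ⊕₃-rotate

x⊕𝟎⊕x≡𝟎 : (x : Z2^ k) → x ⊕ 𝟎 ⊕ x ≡ 𝟎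
x⊕𝟎⊕x≡𝟎 x = trans (cong (_⊕ x) (⊕-identityʳ x)) (⊕-self x)

x⊕x⊕𝟎≡𝟎 : (x : Z2^ k) → x ⊕ x ⊕ 𝟎 ≡ 𝟎
x⊕x⊕𝟎≡𝟎 x = trans (⊕-identityʳ (x ⊕ x)) (⊕-self x)

𝟎⊕x⊕x≡𝟎 : (x : Z2^ k) → 𝟎 ⊕ x ⊕ x ≡ 𝟎
𝟎⊕x⊕x≡𝟎 x = ⊕₃-reverse (x⊕x⊕𝟎≡𝟎 x)

⊕₃-++ : ∀ {k l} {x y z : Z2^ k} {a b c : Z2^ l} →
        x ⊕ y ⊕ z ≡ 𝟎 → a ⊕ b ⊕ c ≡ 𝟎 → (x ++ a) ⊕ (y ++ b) ⊕ (z ++ c) ≡ 𝟎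
⊕₃-++ {k} {l} {x} {y} {z} {a} {b} {c} xyz abc = begin
  (x ++ a) ⊕ (y ++ b) ⊕ (z ++ c)  ≡⟨ cong (_⊕ (z ++ c)) (zipWith-++ _xor_ x a y b) ⟩
  (x ⊕ y ++ a ⊕ b) ⊕ (z ++ c)     ≡⟨ zipWith-++ _xor_ (x ⊕ y) (a ⊕ b) z c ⟩
  x ⊕ y ⊕ z ++ a ⊕ b ⊕ c          ≡⟨ cong₂ _++_ xyz abc ⟩
  𝟎 {k} ++ 𝟎 {l}                  ≡⟨ 𝟎++𝟎 {k} ⟩
  𝟎                               ∎
  where open ≡-Reasoning

-- Chains and the triple condition

nth : ∀ {A : Set} → A → List A → ℕ → A
nth d []       i       = d
nth d (x ∷ xs) zero    = x
nth d (x ∷ xs) (suc i) = nth d xs i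

∈⇒nth : ∀ {A : Set} {d x : A} {xs} → x ∈ xs → ∃[ i ] i < length xs × nth d xs i ≡ x
∈⇒nth (here refl)  = 0 , s≤s z≤n , refl
∈⇒nth (there x∈xs) with i , i<len , eq ← ∈⇒nth x∈xs = suc i , s≤s i<len , eq

length-concat : ∀ {A : Set} (xss : List (List A)) → length (concat xss) ≡ sum (List.map length xss)
length-concat []         = refl
length-concat (xs ∷ xss) = trans (length-++ xs) (cong (length xs +_) (length-concat xss))

infixr 5 _∷_ _++ᶜ_

data Chain {k} : Z2^ k → List (Z2^ k) → Z2^ k → Set where
  []  : Chain x [] x
  _∷_ : ∀ {zs w} → x ⊕ y ⊕ z ≡ 𝟎 → Chain z zs w → Chain x (y ∷ z ∷ zs) w

_++ᶜ_ : ∀ {xs ys} → Chain x xs y → Chain y ys z → Chain x (xs List.++ ys) z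
[]             ++ᶜ chain₂ = chain₂
(xyz ∷ chain₁) ++ᶜ chain₂ = xyz ∷ (chain₁ ++ᶜ chain₂)

chain-triple : ∀ {xs} → Chain x xs z → ∀ j → 2 * j + 2 < length (x ∷ xs) →
  let w = nth 𝟎 (x ∷ xs) in w (2 * j) ⊕ w (2 * j + 1) ⊕ w (2 * j + 2) ≡ 𝟎
chain-triple []          zero    (s≤s ())
chain-triple (xyz ∷ _)   zero    _                 = xyz
chain-triple (_ ∷ chain) (suc j) (s≤s (s≤s bound)) rewrite +-suc j (j + 0) = chain-triple chain j bound

-- Permutations by counting

private
  module 2↔Bool = Inverse 2↔Bool
  module 2↣Bool = Injection (↔⇒↣ 2↔Bool)

toBits : Fin (2 ^ k) → Z2^ k
toBits {zero}  _ = []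
toBits {suc k} i = 2↔Bool.to (quotient (2 ^ k) i) ∷ toBits (remainder {2} (2 ^ k) i)

toBits-injective : Injective _≡_ _≡_ (toBits {k})
toBits-injective {zero}  {zero} {zero} _ = refl
toBits-injective {suc k} {i}    {j}    eq with head≡ , tail≡ ← ∷-injective eq = begin
  i                                                       ≡⟨ combine-remQuot (2 ^ k) i ⟨
  combine (quotient (2 ^ k) i) (remainder {2} (2 ^ k) i)  ≡⟨ cong₂ combine (2↣Bool.injective head≡) (toBits-injective tail≡) ⟩
  combine (quotient (2 ^ k) j) (remainder {2} (2 ^ k) j)  ≡⟨ combine-remQuot (2 ^ k) j ⟩
  j                                                       ∎
  where open ≡-Reasoning

-- If f i ≡ f j with i ≢ j, then a section of f misses i or j; squeezing out the missed index
-- gives an injection X → Fin (n - 1), which composed with e contradicts the pigeonhole principle.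
surjective⇒injective : ∀ {n} {X : Set} {e : Fin n → X} → Injective _≡_ _≡_ e →
                       (f : Fin n → X) → (∀ x → ∃[ i ] f i ≡ x) → Injective _≡_ _≡_ f
surjective⇒injective {suc n} {X} {e} e-injective f f-onto {i} {j} fi≡fj with i Fin.≟ j
... | yes i≡j = i≡j
... | no  i≢j = contradiction (λ {a b} → e-injective ∘ squeeze-injective {e a} {e b}) (<⇒notInjective (n<1+n n))
  where
  pre : X → Fin (suc n)
  pre x = proj₁ (f-onto x)

  f∘pre : ∀ x → f (pre x) ≡ x
  f∘pre x = proj₂ (f-onto x)

  only-fi : ∀ {r} x → f r ≡ f i → r ≡ pre x → x ≡ f i
  only-fi x fr≡fi r≡pre = trans (sym (f∘pre x)) (trans (cong f (sym r≡pre)) fr≡fi)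

  missed : ∃[ r ] ∀ x → r ≢ pre x
  missed with pre (f i) Fin.≟ i
  ... | yes pre≡i = j , λ x j≡pre → i≢j (sym (trans j≡pre (trans (cong pre (only-fi x (sym fi≡fj) j≡pre)) pre≡i)))
  ... | no  pre≢i = i , λ x i≡pre → pre≢i (trans (cong pre (sym (only-fi x refl i≡pre))) (sym i≡pre))

  squeeze : X → Fin n
  squeeze x = punchOut (proj₂ missed x)

  squeeze-injective : Injective _≡_ _≡_ squeeze
  squeeze-injective {x} {y} eq =
    trans (sym (f∘pre x)) (trans (cong f (punchOut-injective (proj₂ missed x) (proj₂ missed y) eq)) (f∘pre y))

size-suc : ∀ k → suc (size k) ≡ 2 ^ k
size-suc k = suc-pred (2 ^ k) {{m^n≢0 2 k}}

covering⇒IsPermOfF : (W : Fin (size k) → Z2^ k) → (∀ y → y ≡ 𝟎 ⊎ ∃[ i ] W i ≡ y) → IsPermOfF k W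
covering⇒IsPermOfF {k} W covers =
  (λ i Wi≡𝟎 → 0≢1+n (W₀-injective (sym Wi≡𝟎))) ,
  Fin.suc-injective ∘ W₀-injective ,
  λ y y≢𝟎 → [ flip contradiction y≢𝟎 , id ]′ (covers y)
  where
  W₀ : Fin (suc (size k)) → Z2^ k
  W₀ zero    = 𝟎
  W₀ (suc i) = W i

  W₀-onto : ∀ y → ∃[ i ] W₀ i ≡ y
  W₀-onto y with covers y
  ... | inj₁ y≡𝟎        = zero , sym y≡𝟎
  ... | inj₂ (i , Wi≡y) = suc i , Wi≡y

  bits : Fin (suc (size k)) → Z2^ k
  bits = toBits ∘ cast (size-suc k)

  bits-injective : Injective _≡_ _≡_ bits
  bits-injective {i} {j} eq =
    toℕ-injective (trans (sym (toℕ-cast _ i)) (trans (cong toℕ (toBits-injective eq)) (toℕ-cast _ j)))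

  W₀-injective : Injective _≡_ _≡_ W₀
  W₀-injective = surjective⇒injective bits-injective W₀ W₀-onto

Chain⇒GoodPerm : ∀ {k} {x z : Z2^ k} {xs} → Chain x xs z → length (x ∷ xs) ≡ size k →
                 (∀ y → y ≡ 𝟎 ⊎ y ∈ x ∷ xs) → GoodPerm k
Chain⇒GoodPerm {k} {x} {xs = xs} chain len covers =
  W , covering⇒IsPermOfF W (Sum.map₂ index ∘ covers) , triples
  where
  W : Fin (size k) → Z2^ k
  W i = nth 𝟎 (x ∷ xs) (toℕ i)

  W-fromℕ< : ∀ {i} .(i<size : i < size k) → W (fromℕ< i<size) ≡ nth 𝟎 (x ∷ xs) i
  W-fromℕ< i<size = cong (nth 𝟎 (x ∷ xs)) (toℕ-fromℕ< i<size)

  index : ∀ {y} → y ∈ x ∷ xs → ∃[ i ] W i ≡ y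
  index y∈ with i , i<len , eq ← ∈⇒nth {d = 𝟎} y∈ =
    let i<size = subst (i <_) len i<len in fromℕ< i<size , trans (W-fromℕ< i<size) eq

  triples : TripleCondition k W
  triples j 2j+2<size =
    trans (cong₂ _⊕_ (cong₂ _⊕_ (W-fromℕ< 2j<size) (W-fromℕ< 2j+1<size)) (W-fromℕ< 2j+2<size))
          (chain-triple chain j (subst (2 * j + 2 <_) (sym len) 2j+2<size))
    where
    2j+1<size : 2 * j + 1 < size k
    2j+1<size = <-trans (+-monoʳ-< (2 * j) (n<1+n 1)) 2j+2<size
    2j<size : 2 * j < size k
    2j<size = <-trans (m<m+n (2 * j) (n<1+n 0)) 2j+1<size

-- Good permutations as walks

record Walk (n m : ℕ) : Set where
  field
    F G    : ℕ → Z2^ n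
    triple : ∀ e → e < m → F e ⊕ G e ⊕ F (suc e) ≡ 𝟎
    covers : ∀ x → x ≡ 𝟎 ⊎ (∃[ e ] e ≤ m × F e ≡ x) ⊎ (∃[ e ] e < m × G e ≡ x)

even⊎odd : ∀ i → ∃[ e ] (i ≡ 2 * e ⊎ i ≡ 2 * e + 1)
even⊎odd zero = 0 , inj₁ refl
even⊎odd (suc i) with even⊎odd i
... | e , inj₁ refl = e , inj₂ (+-comm 1 (2 * e))
... | e , inj₂ refl = suc e , inj₁ (1+[2e+1]≡2[1+e] e)
  where
  1+[2e+1]≡2[1+e] : ∀ e → suc (2 * e + 1) ≡ 2 * suc e
  1+[2e+1]≡2[1+e] = solve-∀

GoodPerm⇒Walk : ∀ {n m} → size n ≡ suc (2 * m) → GoodPerm n → Walk n m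
GoodPerm⇒Walk {n} {m} size≡ (v , (_ , _ , onto) , triples) = record
  { F = F ; G = G ; triple = triple ; covers = covers }
  where
  V : ℕ → Z2^ n
  V i with i <? size n
  ... | yes i<size = v (fromℕ< i<size)
  ... | no  _      = 𝟎

  V-fromℕ< : ∀ {i} (i<size : i < size n) → V i ≡ v (fromℕ< i<size)
  V-fromℕ< {i} i<size with i <? size n
  ... | yes _      = refl
  ... | no  i≮size = contradiction i<size i≮size

  V-toℕ : ∀ i → V (toℕ i) ≡ v i
  V-toℕ i = trans (V-fromℕ< (toℕ<n i)) (cong v (fromℕ<-toℕ i (toℕ<n i)))

  F G : ℕ → Z2^ n
  F e = V (2 * e)
  G e = V (2 * e + 1)

  even<size : ∀ {e} → e ≤ m → 2 * e < size n
  even<size {e} e≤m = subst (2 * e <_) (sym size≡) (s≤s (*-monoʳ-≤ 2 e≤m))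

  odd<size : ∀ {e} → e < m → 2 * e + 1 < size n
  odd<size {e} e<m = subst₂ _<_ (+-comm 1 (2 * e)) (sym size≡) (s≤s (*-monoʳ-< 2 e<m))

  2[1+e]≡2e+2 : ∀ e → 2 * suc e ≡ 2 * e + 2
  2[1+e]≡2e+2 = solve-∀

  triple : ∀ e → e < m → F e ⊕ G e ⊕ F (suc e) ≡ 𝟎
  triple e e<m = begin
    F e ⊕ G e ⊕ V (2 * suc e)  ≡⟨ cong (λ i → F e ⊕ G e ⊕ V i) (2[1+e]≡2e+2 e) ⟩
    F e ⊕ G e ⊕ V (2 * e + 2)  ≡⟨ cong₂ _⊕_ (cong₂ _⊕_ (V-fromℕ< (even<size (<⇒≤ e<m))) (V-fromℕ< (odd<size e<m)))
                                            (V-fromℕ< 2e+2<size) ⟩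
    _                          ≡⟨ triples e 2e+2<size ⟩
    𝟎                          ∎
    where
    open ≡-Reasoning
    2e+2<size : 2 * e + 2 < size n
    2e+2<size = subst (_< size n) (2[1+e]≡2e+2 e) (even<size e<m)

  covers : ∀ x → x ≡ 𝟎 ⊎ (∃[ e ] e ≤ m × F e ≡ x) ⊎ (∃[ e ] e < m × G e ≡ x)
  covers x with ≡-dec _≟ᵇ_ x 𝟎
  ... | yes x≡𝟎 = inj₁ x≡𝟎
  ... | no  x≢𝟎 with i , vi≡x ← onto x x≢𝟎 with even⊎odd (toℕ i)
  ...   | e , inj₁ i≡2e   = inj₂ (inj₁ (e , e≤m , trans (cong V (sym i≡2e)) (trans (V-toℕ i) vi≡x)))
    where
    e≤m : e ≤ m
    e≤m = *-cancelˡ-≤ 2 (s≤s⁻¹ (subst₂ _<_ i≡2e size≡ (toℕ<n i)))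
  ...   | e , inj₂ i≡2e+1 = inj₂ (inj₂ (e , e<m , trans (cong V (sym i≡2e+1)) (trans (V-toℕ i) vi≡x)))
    where
    e<m : e < m
    e<m = *-cancelˡ-< 2 e m (s<s⁻¹ (subst₂ _<_ (trans i≡2e+1 (+-comm (2 * e) 1)) size≡ (toℕ<n i)))

-- Z₂² as GF(4) = Z₂[ω]/(ω² + ω + 1), the bit pair (u , v) standing for uω + v.
Label : Set
Label = Z2^ 2

pattern 0₄  = false ∷ false ∷ []
pattern 1₄  = false ∷ true ∷ []
pattern ω₄  = true ∷ false ∷ []
pattern ω²₄ = true ∷ true ∷ []

infixr 8 ω·_
ω·_ : Label → Label
ω· 0₄  = 0₄
ω· 1₄  = ω₄
ω· ω₄  = ω²₄
ω· ω²₄ = 1₄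

ω³≡1 : ∀ a → ω· ω· ω· a ≡ a
ω³≡1 0₄  = refl
ω³≡1 1₄  = refl
ω³≡1 ω₄  = refl
ω³≡1 ω²₄ = refl

F-label : Label → Parity → Label
F-label a 0ℙ = ω· a
F-label a 1ℙ = a

F-label-triple : ∀ a π → F-label a π ⊕ ω· ω· a ⊕ F-label a (π ⁻¹) ≡ 𝟎
F-label-triple 0₄  0ℙ = refl
F-label-triple 0₄  1ℙ = refl
F-label-triple 1₄  0ℙ = refl
F-label-triple 1₄  1ℙ = refl
F-label-triple ω₄  0ℙ = refl
F-label-triple ω₄  1ℙ = refl
F-label-triple ω²₄ 0ℙ = refl
F-label-triple ω²₄ 1ℙ = refl

F-label-onto : ∀ π b → ∃[ a ] F-label a π ≡ b
F-label-onto 0ℙ b = ω· ω· b , ω³≡1 b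
F-label-onto 1ℙ b = b , refl

-- Lifting a walk from Z₂ⁿ to Z₂ⁿ⁺²

module Lift {n p : ℕ} (W : Walk n (2 + p)) (c-even : parity (suc p) ≡ 0ℙ) where

  open Walk W

  c m : ℕ
  c = suc p
  m = suc c

  Fₐ Gₐ : Label → ℕ → Z2^ (n + 2)
  Fₐ a e = F e ++ F-label a (parity e)
  Gₐ a e = G e ++ ω· ω· a

  lifted-triple : ∀ a {e} → e < m → Fₐ a e ⊕ Gₐ a e ⊕ Fₐ a (suc e) ≡ 𝟎
  lifted-triple a {e} e<m = ⊕₃-++ (triple e e<m)
    (subst (λ π → F-label a (parity e) ⊕ ω· ω· a ⊕ F-label a π ≡ 𝟎) (suc-homo-⁻¹ (suc e))
           (F-label-triple a (parity e)))

  up down : Label → ℕ → List (Z2^ (n + 2))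
  up a zero    = []
  up a (suc j) = up a j List.++ Gₐ a (suc j) ∷ Fₐ a (suc (suc j)) ∷ []

  down a zero    = []
  down a (suc j) = Gₐ a (suc j) ∷ Fₐ a (suc j) ∷ down a j

  up-chain : ∀ a j → j < m → Chain (Fₐ a 1) (up a j) (Fₐ a (suc j))
  up-chain a zero    _     = []
  up-chain a (suc j) 1+j<m = up-chain a j (<-trans (n<1+n j) 1+j<m) ++ᶜ lifted-triple a 1+j<m ∷ []

  down-chain : ∀ a j → j < m → Chain (Fₐ a (suc j)) (down a j) (Fₐ a 1)
  down-chain a zero    _     = []
  down-chain a (suc j) 1+j<m = ⊕₃-reverse (lifted-triple a 1+j<m) ∷ down-chain a j (<-trans (n<1+n j) 1+j<m)

  farTurn₁ nearTurn farTurn₂ nearEnd : List (Z2^ (n + 2))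
  farTurn₁ = (F m ++ ω²₄) ∷ (G c ++ ω²₄) ∷ (𝟎 ++ ω₄) ∷ (G c ++ 1₄) ∷ (F m ++ 0₄) ∷ Fₐ ω²₄ c ∷ []
  nearTurn = (F 0 ++ ω₄) ∷ (G 0 ++ 1₄) ∷ (G 0 ++ 0₄) ∷ (𝟎 ++ 1₄) ∷
             (F 0 ++ 0₄) ∷ (F 0 ++ 1₄) ∷ (G 0 ++ ω²₄) ∷ Fₐ ω₄ 1 ∷ []
  farTurn₂ = (G c ++ ω₄) ∷ (F m ++ 1₄) ∷ (𝟎 ++ ω²₄) ∷ (F m ++ ω₄) ∷ (G c ++ 0₄) ∷ Fₐ 1₄ c ∷ []
  nearEnd  = (F 0 ++ ω²₄) ∷ (G 0 ++ ω₄) ∷ []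

  far-triple : F c ⊕ G c ⊕ F m ≡ 𝟎
  far-triple = triple c (n<1+n c)

  near-triple : F 0 ⊕ G 0 ⊕ F 1 ≡ 𝟎
  near-triple = triple 0 (s≤s z≤n)

  -- The label triples of the turns hold by computation once parity c is known.
  farTurn₁-chain : Chain (Fₐ 0₄ c) farTurn₁ (Fₐ ω²₄ c)
  farTurn₁-chain rewrite c-even =
    ⊕₃-++ (⊕₃-reverse (⊕₃-rotate far-triple)) refl ∷
    ⊕₃-++ (x⊕𝟎⊕x≡𝟎 (G c)) refl ∷
    ⊕₃-++ (⊕₃-rotate far-triple) refl ∷ []

  nearTurn-chain : Chain (Fₐ ω²₄ 1) nearTurn (Fₐ ω₄ 1)
  nearTurn-chain =
    ⊕₃-++ (⊕₃-rotate (⊕₃-rotate near-triple)) refl ∷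
    ⊕₃-++ (x⊕x⊕𝟎≡𝟎 (G 0)) refl ∷
    ⊕₃-++ (𝟎⊕x⊕x≡𝟎 (F 0)) refl ∷
    ⊕₃-++ near-triple refl ∷ []

  farTurn₂-chain : Chain (Fₐ ω₄ c) farTurn₂ (Fₐ 1₄ c)
  farTurn₂-chain rewrite c-even =
    ⊕₃-++ far-triple refl ∷
    ⊕₃-++ (x⊕𝟎⊕x≡𝟎 (F m)) refl ∷
    ⊕₃-++ (⊕₃-reverse far-triple) refl ∷ []

  nearEnd-chain : Chain (Fₐ 1₄ 1) nearEnd (G 0 ++ ω₄)
  nearEnd-chain = ⊕₃-++ (⊕₃-rotate (⊕₃-rotate near-triple)) refl ∷ []

  pieces : List (List (Z2^ (n + 2)))
  pieces = up 0₄ p ∷ farTurn₁ ∷ down ω²₄ p ∷ nearTurn ∷ up ω₄ p ∷ farTurn₂ ∷ down 1₄ p ∷ nearEnd ∷ []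

  tour : List (Z2^ (n + 2))
  tour = Fₐ 0₄ 1 ∷ concat pieces

  tour-chain : Chain (Fₐ 0₄ 1) (concat pieces) (G 0 ++ ω₄)
  tour-chain =
    up-chain 0₄ p p<m ++ᶜ farTurn₁-chain ++ᶜ down-chain ω²₄ p p<m ++ᶜ nearTurn-chain ++ᶜ
    up-chain ω₄ p p<m ++ᶜ farTurn₂-chain ++ᶜ down-chain 1₄ p p<m ++ᶜ nearEnd-chain ++ᶜ []
    where
    p<m : p < m
    p<m = <-trans (n<1+n p) (n<1+n c)

  length-up : ∀ a j → length (up a j) ≡ 2 * j
  length-up a zero    = refl
  length-up a (suc j) = begin
    length (up a j List.++ _)  ≡⟨ length-++ (up a j) ⟩
    length (up a j) + 2        ≡⟨ cong (_+ 2) (length-up a j) ⟩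
    2 * j + 2                  ≡⟨ +-comm (2 * j) 2 ⟩
    2 + 2 * j                  ≡⟨ *-suc 2 j ⟨
    2 * suc j                  ∎
    where open ≡-Reasoning

  length-down : ∀ a j → length (down a j) ≡ 2 * j
  length-down a zero    = refl
  length-down a (suc j) = trans (cong (2 +_) (length-down a j)) (sym (*-suc 2 j))

  length-tour : length tour ≡ 4 * suc (2 * m) + 3
  length-tour = trans (cong suc (length-concat pieces)) counted
    where
    counted : suc (sum (List.map length pieces)) ≡ 4 * suc (2 * m) + 3
    counted rewrite length-up 0₄ p | length-down ω²₄ p | length-up ω₄ p | length-down 1₄ p = arith p
      where
      arith : ∀ p → suc (2 * p + (6 + (2 * p + (8 + (2 * p + (6 + (2 * p + 2)))))))
                  ≡ 4 * suc (2 * suc (suc p)) + 3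
      arith = solve-∀

  ∈-up-F : ∀ {a e j} → e < j → Fₐ a (suc (suc e)) ∈ up a j
  ∈-up-F {a} {e} {suc j} e<1+j with m≤n⇒m<n∨m≡n (s≤s⁻¹ e<1+j)
  ... | inj₁ e<j  = ∈-++⁺ˡ (∈-up-F e<j)
  ... | inj₂ refl = ∈-++⁺ʳ (up a e) (there (here refl))

  ∈-up-G : ∀ {a e j} → e < j → Gₐ a (suc e) ∈ up a j
  ∈-up-G {a} {e} {suc j} e<1+j with m≤n⇒m<n∨m≡n (s≤s⁻¹ e<1+j)
  ... | inj₁ e<j  = ∈-++⁺ˡ (∈-up-G e<j)
  ... | inj₂ refl = ∈-++⁺ʳ (up a e) (here refl)

  ∈-down-F : ∀ {a e j} → e < j → Fₐ a (suc e) ∈ down a j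
  ∈-down-F {a} {e} {suc j} e<1+j with m≤n⇒m<n∨m≡n (s≤s⁻¹ e<1+j)
  ... | inj₁ e<j  = there (there (∈-down-F e<j))
  ... | inj₂ refl = there (here refl)

  ∈-down-G : ∀ {a e j} → e < j → Gₐ a (suc e) ∈ down a j
  ∈-down-G {a} {e} {suc j} e<1+j with m≤n⇒m<n∨m≡n (s≤s⁻¹ e<1+j)
  ... | inj₁ e<j  = there (there (∈-down-G e<j))
  ... | inj₂ refl = here refl

  ∈-piece : ∀ {y} (i : Fin 8) → y ∈ lookup pieces i → y ∈ tour
  ∈-piece i y∈ = there (∈-concat⁺′ y∈ (∈-lookup {xs = pieces} i))

  piece-has : ∀ (i : Fin 8) j → lookup (lookup pieces i) j ∈ tour
  piece-has i j = ∈-piece i (∈-lookup {xs = lookup pieces i} j)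

  𝟎-row : ∀ (b : Label) → 𝟎 {n} ++ b ≡ 𝟎 ⊎ 𝟎 {n} ++ b ∈ tour
  𝟎-row 0₄  = inj₁ (𝟎++𝟎 {n})
  𝟎-row 1₄  = inj₂ (piece-has 3F 3F)
  𝟎-row ω₄  = inj₂ (piece-has 1F 2F)
  𝟎-row ω²₄ = inj₂ (piece-has 5F 2F)

  F-first-row : ∀ b → F 0 ++ b ∈ tour
  F-first-row 0₄  = piece-has 3F 4F
  F-first-row 1₄  = piece-has 3F 5F
  F-first-row ω₄  = piece-has 3F 0F
  F-first-row ω²₄ = piece-has 7F 0F

  G-first-row : ∀ b → G 0 ++ b ∈ tour
  G-first-row 0₄  = piece-has 3F 2F
  G-first-row 1₄  = piece-has 3F 1F
  G-first-row ω₄  = piece-has 7F 1F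
  G-first-row ω²₄ = piece-has 3F 6F

  F-last-row : ∀ b → F m ++ b ∈ tour
  F-last-row 0₄  = piece-has 1F 4F
  F-last-row 1₄  = piece-has 5F 1F
  F-last-row ω₄  = piece-has 5F 3F
  F-last-row ω²₄ = piece-has 1F 0F

  G-last-row : ∀ b → G c ++ b ∈ tour
  G-last-row 0₄  = piece-has 5F 4F
  G-last-row 1₄  = piece-has 1F 3F
  G-last-row ω₄  = piece-has 5F 0F
  G-last-row ω²₄ = piece-has 1F 1F

  pass-F : ∀ a {e} → e ≤ p → Fₐ a (suc e) ∈ tour
  pass-F 0₄  {zero}  _   = here refl
  pass-F 0₄  {suc e} e<p = ∈-piece 0F (∈-up-F e<p)
  pass-F ω₄  {zero}  _   = piece-has 3F 7F
  pass-F ω₄  {suc e} e<p = ∈-piece 4F (∈-up-F e<p)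
  pass-F ω²₄ {e}     e≤p with m≤n⇒m<n∨m≡n e≤p
  ... | inj₁ e<p  = ∈-piece 2F (∈-down-F e<p)
  ... | inj₂ refl = piece-has 1F 5F
  pass-F 1₄  {e}     e≤p with m≤n⇒m<n∨m≡n e≤p
  ... | inj₁ e<p  = ∈-piece 6F (∈-down-F e<p)
  ... | inj₂ refl = piece-has 5F 5F

  pass-G : ∀ a {e} → e < p → Gₐ a (suc e) ∈ tour
  pass-G 0₄  e<p = ∈-piece 0F (∈-up-G e<p)
  pass-G ω²₄ e<p = ∈-piece 2F (∈-down-G e<p)
  pass-G ω₄  e<p = ∈-piece 4F (∈-up-G e<p)
  pass-G 1₄  e<p = ∈-piece 6F (∈-down-G e<p)

  F-row : ∀ {e} b → e ≤ m → F e ++ b ∈ tour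
  F-row {zero}  b _ = F-first-row b
  F-row {suc e} b (s≤s e≤c) with m≤n⇒m<n∨m≡n e≤c
  ... | inj₂ refl = F-last-row b
  ... | inj₁ e<c  with a , label≡b ← F-label-onto (parity (suc e)) b =
    subst (λ ℓ → F (suc e) ++ ℓ ∈ tour) label≡b (pass-F a (s≤s⁻¹ e<c))

  G-row : ∀ {e} b → e < m → G e ++ b ∈ tour
  G-row {zero}  b _ = G-first-row b
  G-row {suc e} b (s≤s e<c) with m≤n⇒m<n∨m≡n (s≤s⁻¹ e<c)
  ... | inj₂ refl = G-last-row b
  ... | inj₁ e<p  = subst (λ ℓ → G (suc e) ++ ℓ ∈ tour) (ω³≡1 b) (pass-G (ω· b) e<p)

  tour-covers : ∀ y → y ≡ 𝟎 ⊎ y ∈ tour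
  tour-covers y with x , b , refl ← splitAt n y with covers x
  ... | inj₁ refl                    = 𝟎-row b
  ... | inj₂ (inj₁ (e , e≤m , refl)) = inj₂ (F-row b e≤m)
  ... | inj₂ (inj₂ (e , e<m , refl)) = inj₂ (G-row b e<m)

size[n+2] : ∀ n → size (n + 2) ≡ 4 * size n + 3
size[n+2] n = ℕ.suc-injective (begin
  suc (size (n + 2))    ≡⟨ size-suc (n + 2) ⟩
  2 ^ (n + 2)           ≡⟨ ^-distribˡ-+-* 2 n 2 ⟩
  2 ^ n * 4             ≡⟨ cong (_* 4) (size-suc n) ⟨
  suc (size n) * 4      ≡⟨ arith (size n) ⟩
  suc (4 * size n + 3)  ∎)
  where
  open ≡-Reasoning
  arith : ∀ s → suc s * 4 ≡ suc (4 * s + 3)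
  arith = solve-∀

size[3+n] : ∀ n → size (3 + n) ≡ suc (2 * (3 + 4 * size n))
size[3+n] n = ℕ.suc-injective (begin
  suc (size (3 + n))                ≡⟨ size-suc (3 + n) ⟩
  2 * (2 * (2 * 2 ^ n))             ≡⟨ cong (λ x → 2 * (2 * (2 * x))) (size-suc n) ⟨
  2 * (2 * (2 * suc (size n)))      ≡⟨ arith (size n) ⟩
  suc (suc (2 * (3 + 4 * size n)))  ∎)
  where
  open ≡-Reasoning
  arith : ∀ s → 2 * (2 * (2 * suc s)) ≡ suc (suc (2 * (3 + 4 * s)))
  arith = solve-∀

proposition1 : (n : ℕ) → 2 < n → GoodPerm n → GoodPerm (n + 2)
proposition1 (suc (suc (suc n))) (s≤s (s≤s (s≤s _))) perm =
  Chain⇒GoodPerm tour-chain (trans length-tour (sym size≡)) tour-covers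
  where
  -- c = 2 + 4 · size n is even.
  open Lift {p = suc (4 * size n)} (GoodPerm⇒Walk (size[3+n] n) perm) (*-homo-* 4 (size n))

  size≡ : size (3 + n + 2) ≡ 4 * suc (2 * (3 + 4 * size n)) + 3
  size≡ = trans (size[n+2] (3 + n)) (cong (λ s → 4 * s + 3) (size[3+n] n))
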